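{- Let $S$ be a numerical semigroup with genus $g(S)$. Then $0 \leq \sigma(s) \leq \frac{g(S)}{2}$ for every $s \in S \cap [0,c(S)]$.
   Context: A numerical semigroup is a subset $S \subseteq \mathbb{N} = \{0,1,2,\ldots\}$ closed under addition, containing $0$, with finite complement. Its genus is $g(S) := |\mathbb{N}\setminus S|$, its Frobenius number $F(S) := \max(\mathbb{N}\setminus S)$, and its conductor $c(S) := F(S)+1$. For $s \in S \cap [0,c(S)]$ define $\sigma(s) := \frac{s}{2} - |S \cap [0,s]| + 1$. -}

module Defs where

open import Data.Bool using (Bool; true; false; if_then_else_)
open import Data.Nat using (ℕ; zero; suc; _+_; _≤_)
open import Data.Integer using (ℤ; +_)
open import Data.Rational using (ℚ; _/_; _-_)
import Data.Rational as ℚ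
open import Relation.Binary.PropositionalEquality using (_≡_)

record NumericalSemigroup : Set where
  field
    mem      : ℕ → Bool
    mem-zero : mem 0 ≡ true
    mem-add  : ∀ a b → mem a ≡ true → mem b ≡ true → mem (a + b) ≡ true
    bound    : ℕ
    cofinite : ∀ n → bound ≤ n → mem n ≡ true

open NumericalSemigroup public

countBelow : (ℕ → Bool) → ℕ → ℕ
countBelow p zero    = zero
countBelow p (suc b) = if p b then suc (countBelow p b) else countBelow p b

not : Bool → Bool
not true  = false
not false = true

-- genus g(S) = |ℕ \ S|  (all gaps lie below the bound)
genus : NumericalSemigroup → ℕ
genus S = countBelow (λ n → not (mem S n)) (bound S)

conductorBelow : (ℕ → Bool) → ℕ → ℕ
conductorBelow p zero    = zero
conductorBelow p (suc b) = if p b then conductorBelow p b else suc b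

-- conductor c(S) = F(S) + 1, where F(S) = max (ℕ \ S)  (c(ℕ) = 0)
conductor : NumericalSemigroup → ℕ
conductor S = conductorBelow (mem S) (bound S)

countUpTo : NumericalSemigroup → ℕ → ℕ
countUpTo S s = countBelow (mem S) (suc s)

σ : NumericalSemigroup → ℕ → ℚ
σ S s = ((+ s / 2) - (+ countUpTo S s / 1)) ℚ.+ ℚ.1ℚ

-- Write n(t) = |S ∩ [0, t]|, so that 2σ(s) = s + 2 − 2n(s).
--
-- Upper bound: [0, s] holds n(s) elements of S and at most g gaps, and 0 ∈ S,
-- so s + 2 ≤ (n(s) + g) + n(s).
--
-- Lower bound: for a gap h, x ↦ h − x maps S ∩ [0, h] into the gaps of [0, h], so
-- 2n(h) ≤ h + 1. Hence 2n(t) ≤ t + 2 for all t ≤ h + 1, by descending induction on t: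
-- if t + 1 is a gap use the pairing there, otherwise 2n(t + 1) = 2n(t) + 2.
-- Taking h = F(S) covers every s ≤ c(S), the case S = ℕ being s = 0.
module Submission where

open import Defs
open import Data.Bool using (Bool; true; false)
open import Data.Bool.Properties using (¬-not)
open import Data.Sum using (inj₁; inj₂)
open import Data.Nat using (NonZero; ℕ; zero; suc; _+_; _*_; _∸_; _≤_; _<_; _≤′_; ≤′-refl; ≤′-step; z≤n; s≤s; s≤s⁻¹; _<?_)
open import Data.Nat.Properties
open import Data.Integer using (+_; _⊖_)
import Data.Integer as ℤ
import Data.Integer.Properties as ℤ
open import Data.Rational using (0ℚ; _/_; toℚᵘ)
import Data.Rational as ℚ
import Data.Rational.Properties as ℚ
open import Data.Rational.Unnormalised as ℚᵘ using (0ℚᵘ; _≃_; *≡*; *≤*)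
import Data.Rational.Unnormalised.Properties as ℚᵘ
open import Data.Product using (_×_; _,_)
open import Function using (_∘_; const)
open import Relation.Nullary using (yes; no; contradiction)
open import Relation.Binary.PropositionalEquality

private
  variable
    p q : ℕ → Bool
    m n b : ℕ

countBelow-true : ∀ p → p n ≡ true → countBelow p (suc n) ≡ suc (countBelow p n)
countBelow-true p pn rewrite pn = refl

countBelow-false : ∀ p → p n ≡ false → countBelow p (suc n) ≡ countBelow p n
countBelow-false p pn rewrite pn = refl

countBelow-suc-≤ : ∀ p n → countBelow p (suc n) ≤ suc (countBelow p n)
countBelow-suc-≤ p n with p n
... | true  = ≤-refl
... | false = n≤1+n _

countBelow-≤-suc : ∀ p n → countBelow p n ≤ countBelow p (suc n)
countBelow-≤-suc p n with p n
... | true  = n≤1+n _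
... | false = ≤-refl

countBelow-snoc : ∀ p n → countBelow p (suc n) ≡ countBelow p n + countBelow (const (p n)) 1
countBelow-snoc p n with p n
... | true  = sym (+-comm (countBelow p n) 1)
... | false = sym (+-identityʳ (countBelow p n))

countBelow-mono-≤ : ∀ p → m ≤ n → countBelow p m ≤ countBelow p n
countBelow-mono-≤ p = go ∘ ≤⇒≤′
  where
  go : m ≤′ n → countBelow p m ≤ countBelow p n
  go ≤′-refl        = ≤-refl
  go (≤′-step m≤′n) = ≤-trans (go m≤′n) (countBelow-≤-suc p _)

countBelow-cong : ∀ n → (∀ x → x < n → p x ≡ q x) → countBelow p n ≡ countBelow q n
countBelow-cong zero    p≗q = refl
countBelow-cong {p} {q} (suc n) p≗q
  rewrite p≗q n ≤-refl | countBelow-cong n (λ x x<n → p≗q x (m≤n⇒m≤1+n x<n)) = refl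

countBelow-shift : ∀ p n → countBelow p (suc n) ≡ countBelow (p ∘ suc) n + countBelow p 1
countBelow-shift p zero    = refl
countBelow-shift p (suc n) with p (suc n)
... | true  = cong suc (countBelow-shift p n)
... | false = countBelow-shift p n

countBelow-reverse : ∀ p n → countBelow p n ≡ countBelow (λ x → p (n ∸ suc x)) n
countBelow-reverse p zero    = refl
countBelow-reverse p (suc n) = begin
  countBelow p (suc n)                                      ≡⟨ countBelow-shift p n ⟩
  countBelow (p ∘ suc) n + countBelow p 1                   ≡⟨ cong (_+ countBelow p 1) (countBelow-reverse (p ∘ suc) n) ⟩
  countBelow (λ x → p (suc (n ∸ suc x))) n + countBelow p 1 ≡⟨ cong (_+ countBelow p 1) (countBelow-cong n suc∸suc) ⟩
  countBelow r n + countBelow p 1                           ≡⟨ cong (λ m → countBelow r n + countBelow (const (p m)) 1) (n∸n≡0 n) ⟨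
  countBelow r n + countBelow (const (r n)) 1               ≡⟨ countBelow-snoc r n ⟨
  countBelow r (suc n)                                      ∎
  where
  open ≡-Reasoning
  r : ℕ → Bool
  r x = p (n ∸ x)
  suc∸suc : ∀ x → x < n → p (suc (n ∸ suc x)) ≡ r x
  suc∸suc x x<n = cong p (sym (+-∸-assoc 1 x<n))

countBelow-disjoint : ∀ n → (∀ x → x < n → p x ≡ true → q x ≡ false) →
                      countBelow p n + countBelow q n ≤ n
countBelow-disjoint zero _ = z≤n
countBelow-disjoint {p} {q} (suc n) disjoint
  with p n in pn | q n in qn | countBelow-disjoint n (λ x x<n → disjoint x (m≤n⇒m≤1+n x<n))
... | true  | true  | _     = contradiction (trans (sym qn) (disjoint n ≤-refl pn)) λ ()
... | true  | false | below = s≤s below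
... | false | true  | below = subst (_≤ suc n) (sym (+-suc _ _)) (s≤s below)
... | false | false | below = m≤n⇒m≤1+n below

countBelow-complement : ∀ p n → countBelow p n + countBelow (not ∘ p) n ≡ n
countBelow-complement p zero = refl
countBelow-complement p (suc n) with p n
... | true  = cong suc (countBelow-complement p n)
... | false = trans (+-suc _ _) (cong suc (countBelow-complement p n))

countBelow-≤-vanishing : ∀ p → (∀ n → b ≤ n → p n ≡ false) → ∀ n → countBelow p n ≤ countBelow p b
countBelow-≤-vanishing p vanish zero = z≤n
countBelow-≤-vanishing {b} p vanish (suc n) with n <? b
... | yes n<b = countBelow-mono-≤ p n<b
... | no  n≮b = begin
  countBelow p (suc n) ≡⟨ countBelow-false p (vanish n (≮⇒≥ n≮b)) ⟩
  countBelow p n       ≤⟨ countBelow-≤-vanishing p vanish n ⟩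
  countBelow p b       ∎
  where open ≤-Reasoning

conductorBelow-gap : ∀ p b {F} → conductorBelow p b ≡ suc F → p F ≡ false
conductorBelow-gap p (suc b) c≡1+F with p b in pb
... | true  = conductorBelow-gap p b c≡1+F
... | false = subst (λ x → p x ≡ false) (suc-injective c≡1+F) pb

gap-pairing : ∀ S {h} → mem S h ≡ false → 2 * countUpTo S h ≤ suc h
gap-pairing S {h} gap = begin
  2 * k                                         ≡⟨ cong (λ m → k + m) (+-identityʳ k) ⟩
  k + k                                         ≡⟨ cong (λ m → k + m) (countBelow-reverse (mem S) (suc h)) ⟩
  k + countBelow (λ x → mem S (h ∸ x)) (suc h) ≤⟨ countBelow-disjoint (suc h) mirror-gap ⟩
  suc h                                         ∎
  where
  open ≤-Reasoning
  k = countUpTo S h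
  mirror-gap : ∀ x → x < suc h → mem S x ≡ true → mem S (h ∸ x) ≡ false
  mirror-gap x x<1+h x∈S = ¬-not λ h∸x∈S →
    contradiction (trans (sym gap) (subst (λ y → mem S y ≡ true) (m+[n∸m]≡n (s≤s⁻¹ x<1+h))
                                           (mem-add S x (h ∸ x) x∈S h∸x∈S))) λ ()

countUpTo-pos : ∀ S s → 1 ≤ countUpTo S s
countUpTo-pos S s = begin
  1                      ≡⟨ countBelow-true (mem S) (mem-zero S) ⟨
  countBelow (mem S) 1   ≤⟨ countBelow-mono-≤ (mem S) (s≤s z≤n) ⟩
  countUpTo S s          ∎
  where open ≤-Reasoning

gaps-≤-genus : ∀ S n → countBelow (not ∘ mem S) n ≤ genus S
gaps-≤-genus S = countBelow-≤-vanishing (not ∘ mem S) (λ n b≤n → cong not (cofinite S n b≤n))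

countUpTo-upper : ∀ S s → s + 2 ≤ 2 * countUpTo S s + genus S
countUpTo-upper S s = begin
  s + 2                 ≡⟨ +-comm s 2 ⟩
  suc (suc s)           ≡⟨ cong suc (countBelow-complement (mem S) (suc s)) ⟨
  1 + (k + gaps)        ≤⟨ +-mono-≤ (countUpTo-pos S s) (+-monoʳ-≤ k (gaps-≤-genus S (suc s))) ⟩
  k + (k + genus S)     ≡⟨ +-assoc k k (genus S) ⟨
  k + k + genus S       ≡⟨ cong (λ m → k + m + genus S) (+-identityʳ k) ⟨
  2 * k + genus S       ∎
  where
  open ≤-Reasoning
  k    = countUpTo S s
  gaps = countBelow (not ∘ mem S) (suc s)

countUpTo-after-gap : ∀ S {h} → mem S h ≡ false → 2 * countUpTo S (suc h) ≤ suc h + 2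
countUpTo-after-gap S {h} gap = begin
  2 * countUpTo S (suc h)     ≤⟨ *-monoʳ-≤ 2 (countBelow-suc-≤ (mem S) (suc h)) ⟩
  2 * suc (countUpTo S h)     ≡⟨ *-suc 2 (countUpTo S h) ⟩
  2 + 2 * countUpTo S h       ≤⟨ +-monoʳ-≤ 2 (gap-pairing S gap) ⟩
  2 + suc h                   ≡⟨ +-comm 2 (suc h) ⟩
  suc h + 2                   ∎
  where open ≤-Reasoning

countUpTo-before-gap : ∀ S t d → mem S (t + d) ≡ false → 2 * countUpTo S t ≤ t + 2
countUpTo-before-gap S t zero gap = begin
  2 * countUpTo S t ≤⟨ gap-pairing S (subst (λ x → mem S x ≡ false) (+-identityʳ t) gap) ⟩
  suc t             ≤⟨ n≤1+n (suc t) ⟩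
  2 + t             ≡⟨ +-comm 2 t ⟩
  t + 2             ∎
  where open ≤-Reasoning
countUpTo-before-gap S t (suc d) gap with mem S (suc t) in 1+t∈S
... | true = s≤s⁻¹ (≤-trans (n≤1+n _) (begin
  suc (suc (2 * countUpTo S t)) ≡⟨ *-suc 2 (countUpTo S t) ⟨
  2 * suc (countUpTo S t)       ≡⟨ cong (2 *_) (countBelow-true (mem S) 1+t∈S) ⟨
  2 * countUpTo S (suc t)       ≤⟨ countUpTo-before-gap S (suc t) d (subst (λ x → mem S x ≡ false) (+-suc t d) gap) ⟩
  suc t + 2                     ∎))
  where open ≤-Reasoning
... | false = begin
  2 * countUpTo S t        ≡⟨ cong (2 *_) (countBelow-false (mem S) 1+t∈S) ⟨
  2 * countUpTo S (suc t)  ≤⟨ gap-pairing S 1+t∈S ⟩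
  2 + t                    ≡⟨ +-comm 2 t ⟩
  t + 2                    ∎
  where open ≤-Reasoning

countUpTo-lower : ∀ S s → s ≤ conductor S → 2 * countUpTo S s ≤ s + 2
countUpTo-lower S s s≤c with conductor S in c≡ | s≤c
... | zero  | z≤n = *-monoʳ-≤ 2 (countBelow-suc-≤ (mem S) 0)
... | suc F | s≤1+F with m≤n⇒m<n∨m≡n s≤1+F | conductorBelow-gap (mem S) (bound S) c≡
...   | inj₂ refl  | F∉S = countUpTo-after-gap S F∉S
...   | inj₁ s<1+F | F∉S = countUpTo-before-gap S s (F ∸ s) (subst (λ x → mem S x ≡ false) F≡s+[F∸s] F∉S)
  where F≡s+[F∸s] = sym (m+[n∸m]≡n (s≤s⁻¹ s<1+F))

0≤k⇒0≤k/d : ∀ {k} d .{{_ : NonZero d}} → ℤ.0ℤ ℤ.≤ k → 0ℚᵘ ℚᵘ.≤ k ℚᵘ./ d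
0≤k⇒0≤k/d {k} (suc d) 0≤k = *≤* (subst (ℤ.0ℤ ℤ.≤_) (sym (ℤ.*-identityʳ k)) 0≤k)

/-monoˡ-≤ : ∀ {k l} d .{{_ : NonZero d}} → k ℤ.≤ l → k ℚᵘ./ d ℚᵘ.≤ l ℚᵘ./ d
/-monoˡ-≤ (suc d) k≤l = *≤* (ℤ.*-monoʳ-≤-nonNeg (+ suc d) k≤l)

↥-half-sub-add-one : ∀ s k → ℚᵘ.↥ (+ s ℚᵘ./ 2 ℚᵘ.- + k ℚᵘ./ 1 ℚᵘ.+ ℚᵘ.1ℚᵘ) ≡ (s + 2) ⊖ (2 * k)
↥-half-sub-add-one s k = begin
  (+ s ℤ.* + 1 ℤ.+ ℤ.- + k ℤ.* + 2) ℤ.* + 1 ℤ.+ + 1 ℤ.* + 2 ≡⟨ normalise (+ s) (+ k) ⟩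
  + s ℤ.+ + 2 ℤ.- + 2 ℤ.* + k                              ≡⟨ cong₂ ℤ._-_ (ℤ.pos-+ s 2) (ℤ.pos-* 2 k) ⟨
  + (s + 2) ℤ.- + (2 * k)                                   ≡⟨ ℤ.[+m]-[+n]≡m⊖n (s + 2) (2 * k) ⟩
  (s + 2) ⊖ (2 * k)                                         ∎
  where
  open ≡-Reasoning
  open import Data.Integer.Tactic.RingSolver using (solve-∀)
  normalise : ∀ x y → (x ℤ.* + 1 ℤ.+ ℤ.- y ℤ.* + 2) ℤ.* + 1 ℤ.+ + 1 ℤ.* + 2 ≡ x ℤ.+ + 2 ℤ.- + 2 ℤ.* y
  normalise = solve-∀

-- ℚ normalises, so σ is compared through its unnormalised image, with numerator 2σ(s).
toℚᵘ-σ : ∀ S s → toℚᵘ (σ S s) ≃ ((s + 2) ⊖ (2 * countUpTo S s)) ℚᵘ./ 2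
toℚᵘ-σ S s = begin
  toℚᵘ (σ S s)                                          ≈⟨ ℚ.toℚᵘ-homo-+ (+ s / 2 ℚ.- + k / 1) ℚ.1ℚ ⟩
  toℚᵘ (+ s / 2 ℚ.- + k / 1) ℚᵘ.+ ℚᵘ.1ℚᵘ                 ≈⟨ ℚᵘ.+-congˡ ℚᵘ.1ℚᵘ (ℚ.toℚᵘ-homo-+ (+ s / 2) (ℚ.- (+ k / 1))) ⟩
  toℚᵘ (+ s / 2) ℚᵘ.+ toℚᵘ (ℚ.- (+ k / 1)) ℚᵘ.+ ℚᵘ.1ℚᵘ  ≈⟨ ℚᵘ.+-congˡ ℚᵘ.1ℚᵘ (ℚᵘ.+-cong (ℚ.toℚᵘ-fromℚᵘ (+ s ℚᵘ./ 2)) minus-k) ⟩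
  + s ℚᵘ./ 2 ℚᵘ.- + k ℚᵘ./ 1 ℚᵘ.+ ℚᵘ.1ℚᵘ                 ≈⟨ *≡* (cong (ℤ._* + 2) (↥-half-sub-add-one s k)) ⟩
  ((s + 2) ⊖ (2 * k)) ℚᵘ./ 2                            ∎
  where
  open ℚᵘ.≃-Reasoning
  k = countUpTo S s
  minus-k : toℚᵘ (ℚ.- (+ k / 1)) ≃ ℚᵘ.- (+ k ℚᵘ./ 1)
  minus-k = ℚᵘ.≃-trans (ℚ.toℚᵘ-homo‿- (+ k / 1)) (ℚᵘ.-‿cong (ℚ.toℚᵘ-fromℚᵘ (+ k ℚᵘ./ 1)))

σ-nonNeg : ∀ S s → 2 * countUpTo S s ≤ s + 2 → 0ℚ ℚ.≤ σ S s
σ-nonNeg S s 2k≤s+2 = ℚ.toℚᵘ-cancel-≤ (ℚᵘ.≤-respʳ-≃ (ℚᵘ.≃-sym (toℚᵘ-σ S s)) (0≤k⇒0≤k/d 2 0≤2σ))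
  where
  0≤2σ : ℤ.0ℤ ℤ.≤ (s + 2) ⊖ (2 * countUpTo S s)
  0≤2σ = subst (ℤ.0ℤ ℤ.≤_) (sym (ℤ.⊖-≥ 2k≤s+2)) (ℤ.+≤+ z≤n)

σ-≤-half-genus : ∀ S s → s + 2 ≤ 2 * countUpTo S s + genus S → σ S s ℚ.≤ + genus S / 2
σ-≤-half-genus S s s+2≤2k+g =
  ℚ.toℚᵘ-cancel-≤ (ℚᵘ.≤-respˡ-≃ (ℚᵘ.≃-sym (toℚᵘ-σ S s))
                   (ℚᵘ.≤-respʳ-≃ (ℚᵘ.≃-sym (ℚ.toℚᵘ-fromℚᵘ (+ genus S ℚᵘ./ 2))) (/-monoˡ-≤ 2 2σ≤g)))
  where
  open ℤ.≤-Reasoning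
  2k = 2 * countUpTo S s
  2σ≤g : (s + 2) ⊖ 2k ℤ.≤ + genus S
  2σ≤g = begin
    (s + 2) ⊖ 2k             ≤⟨ ℤ.⊖-monoˡ-≤ 2k s+2≤2k+g ⟩
    (2k + genus S) ⊖ 2k      ≡⟨ ℤ.⊖-≥ (m≤m+n 2k (genus S)) ⟩
    + (2k + genus S ∸ 2k)    ≡⟨ cong +_ (m+n∸m≡n 2k (genus S)) ⟩
    + genus S                ∎

proposition2p9 : (S : NumericalSemigroup) (s : ℕ) →
    mem S s ≡ true → s ≤ conductor S →
    (0ℚ ℚ.≤ σ S s) × (σ S s ℚ.≤ (+ genus S / 2))
proposition2p9 S s _ s≤c = σ-nonNeg S s (countUpTo-lower S s s≤c) , σ-≤-half-genus S s (countUpTo-upper S s)
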